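{- Let $n\ge 2$. Let the left star $S^{L}$ be the centrally symmetric pseudotriangulation of $\mathcal{D}_n$ consisting of all left central chords $p^{L}$ for $p \in \{0,\dots,n-1,\bar 0,\dots,\overline{n-1}\}$, and the right star $S^{R}$ the one consisting of all right central chords $p^{R}$. Then the flip distance between $S^{L}$ and $S^{R}$ (their distance in the flip graph on centrally symmetric pseudotriangulations of $\mathcal{D}_n$) is exactly $2n-2$.
   Context: Let $\mathcal{D}_n$ be the configuration consisting of a regular convex $2n$-gon together with a closed disk $\mathbb{D}$ centered at the center of the polygon, with radius small enough that $\mathbb{D}$ meets only the long diagonals (those joining opposite vertices) of the $2n$-gon. Label the vertices counterclockwise $0,1,\dots,n-1,\bar 0,\bar 1,\dots,\overline{n-1}$, so that $p$ and $\bar p$ are symmetric with respect to the center. The chords of $\mathcal{D}_n$ are: all diagonals of the $2n$-gon except the long ones, together with the segments with one endpoint at a vertex of the $2n$-gon and tangent to $\mathbb{D}$. Each vertex $p$ is the endpoint of two such tangent chords: $p^{L}$, passing tangent to $\mathbb{D}$ on its left, and $p^{R}$, passing tangent on its right (central chords). Two chords cross if their relative interiors intersect. A centrally symmetric pseudotriangulation of $\mathcal{D}_n$ is an inclusion-maximal crossing-free set of chords invariant under the central symmetry; it contains exactly $2n$ chords. A flip replaces one centrally symmetric pair of chords of such a pseudotriangulation by the unique other centrally symmetric pair of chords yielding again a centrally symmetric pseudotriangulation. The flip graph has these pseudotriangulations as vertices and flips as edges; the flip distance is the graph distance. -}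

module Defs where

open import Data.Nat using (ℕ; zero; suc; _+_; _*_; _∸_; _<_; _≤_)
open import Data.Nat.DivMod using (_%_)
open import Data.Fin using (Fin; toℕ)
open import Data.Bool using (Bool; true; false; not)
open import Data.Product using (Σ; _×_; _,_)
open import Data.Sum using (_⊎_)
open import Data.Empty using (⊥)
open import Relation.Nullary using (¬_)
open import Relation.Binary.PropositionalEquality using (_≡_; _≢_)

-- Vertices of the regular 2n-gon, labelled as in the paper:
-- (p , false) is the vertex p, (p , true) is the vertex p̄ (p ∈ {0,…,n-1}).
Vertex : ℕ → Set
Vertex n = Fin n × Bool

-- position of a vertex in counterclockwise order 0,1,…,n-1,0̄,…,(n-1)̄
pos : {n : ℕ} → Vertex n → ℕ
pos (p , false) = toℕ p
pos {n} (p , true) = n + toℕ p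

bar : {n : ℕ} → Vertex n → Vertex n
bar (p , b) = (p , not b)

_mod_ : ℕ → ℕ → ℕ
a mod zero = a
a mod suc m = a % suc m

-- counterclockwise offset (number of steps) from position a to position b
-- on the 2n-gon, a value in {0,…,2n-1}   (a < 2n assumed; b arbitrary)
offset : ℕ → ℕ → ℕ → ℕ
offset n a b = (b + ((n + n) ∸ a)) mod (n + n)

data Side : Set where
  L R : Side

-- Chords of 𝒟_n.
--  * diag v k : the diagonal joining v to the vertex 2 + k steps
--    counterclockwise from v; as k ranges over Fin (n ∸ 2) the length
--    2 + k ranges over {2,…,n-1}, so every non-long diagonal has
--    exactly one such representation (edges and long diagonals excluded).
--  * cen L v , cen R v : the central chords v^L , v^R.
data Chord (n : ℕ) : Set where
  diag : Vertex n → Fin (n ∸ 2) → Chord n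
  cen  : Side → Vertex n → Chord n

len : (n : ℕ) → Fin (n ∸ 2) → ℕ
len n k = 2 + toℕ k

symC : {n : ℕ} → Chord n → Chord n
symC (diag v k) = diag (bar v) k
symC (cen s v) = cen s (bar v)

-- position x lies strictly inside the short arc of diag v k
-- (the side of the diagonal not containing the disk)
Inside : {n : ℕ} → Vertex n → Fin (n ∸ 2) → ℕ → Set
Inside {n} v k x = (0 < offset n (pos v) x) × (offset n (pos v) x < len n k)

-- position x lies strictly on the disk side of diag v k (not an endpoint)
Outside : {n : ℕ} → Vertex n → Fin (n ∸ 2) → ℕ → Set
Outside {n} v k x = len n k < offset n (pos v) x

CCWHalf : {n : ℕ} → Vertex n → Vertex n → Set
CCWHalf {n} p q = (0 < offset n (pos p) (pos q)) × (offset n (pos p) (pos q) < n)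

-- Crossing of chords (relative interiors intersect):
--  * two diagonals cross iff their endpoints strictly interleave;
--  * a diagonal and a central chord from p cross iff p lies strictly on the
--    side of the diagonal not containing the disk;
--  * p^L and q^R cross iff q is strictly counterclockwise of p by less
--    than n steps; two central chords of the same side never cross.
Cross : {n : ℕ} → Chord n → Chord n → Set
Cross {n} (diag v k) (diag w k') =
  (Inside v k (pos w) × Outside v k (pos w + len n k'))
  ⊎ (Inside v k (pos w + len n k') × Outside v k (pos w))
Cross (diag v k) (cen s p) = Inside v k (pos p)
Cross (cen s p) (diag v k) = Inside v k (pos p)
Cross (cen L p) (cen L q) = ⊥
Cross (cen R p) (cen R q) = ⊥
Cross (cen L p) (cen R q) = CCWHalf p q
Cross (cen R q) (cen L p) = CCWHalf p q

ChordSet : ℕ → Set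
ChordSet n = Chord n → Bool

CrossingFree : {n : ℕ} → ChordSet n → Set
CrossingFree {n} T = (c d : Chord n) → T c ≡ true → T d ≡ true → ¬ Cross c d

Maximal : {n : ℕ} → ChordSet n → Set
Maximal {n} T = (c : Chord n) → ((d : Chord n) → T d ≡ true → ¬ Cross c d) → T c ≡ true

CentrallySymmetric : {n : ℕ} → ChordSet n → Set
CentrallySymmetric {n} T = (c : Chord n) → T c ≡ true → T (symC c) ≡ true

CSPT : {n : ℕ} → ChordSet n → Set
CSPT T = CrossingFree T × Maximal T × CentrallySymmetric T

Flip : {n : ℕ} → ChordSet n → ChordSet n → Set
Flip {n} T T' =
  CSPT T × CSPT T' ×
  Σ (Chord n) λ c → Σ (Chord n) λ c' →
    (T c ≡ true) × (T' c ≡ false) × (T' c' ≡ true) × (T c' ≡ false) ×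
    ((d : Chord n) → d ≢ c → d ≢ symC c → d ≢ c' → d ≢ symC c' → T d ≡ T' d)

data Walk {n : ℕ} : ChordSet n → ChordSet n → ℕ → Set where
  here : {A B : ChordSet n} → ((c : Chord n) → A c ≡ B c) → Walk A B 0
  step : {A B C : ChordSet n} {k : ℕ} → Flip A C → Walk C B k → Walk A B (suc k)

FlipDistance : {n : ℕ} → ChordSet n → ChordSet n → ℕ → Set
FlipDistance A B d = Walk A B d × ((k : ℕ) → Walk A B k → d ≤ k)

leftStar : (n : ℕ) → ChordSet n
leftStar n (cen L _) = true
leftStar n _ = false

rightStar : (n : ℕ) → ChordSet n
rightStar n (cen R _) = true
rightStar n _ = false

{-# OPTIONS --safe #-}
-- For a pseudotriangulation T let a(T) and b(T) count the indices p ∈ {0,…,n-1}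
-- with p^L ∈ T, resp. p^R ∈ T. A flip removes one symmetric pair {c, c̄}, whose members share an
-- index, so a drops and b grows by at most one per flip. Since p^L (or p̄^L) crosses r^R whenever
-- p ≠ r, a(T) ≥ 2 forces b(T) = 0. Hence (a ∸ 1) − (b ∸ 1) decreases by at most one per flip,
-- while it equals n − 1 at S^L and −(n − 1) at S^R.
--
-- The diagonals 0–2, …, 0–(j+1), their mirror images, and the left central chords at
-- 0, j+1, …, n−1 and their mirror images form a c.s. pseudotriangulation. Growing this fan from S^L
-- costs one flip per diagonal (n − 2 flips); trading (n−1)^L for 0^R and then 0^L for (n−1)^R costs
-- two more; shrinking the fan again, now with right central chords, costs another n − 2.
module Submission where

open import Defs
open import Data.Nat using (ℕ; zero; suc; _+_; _*_; _∸_; _<_; _≤_; z≤n; s≤s; z<s; s<s; s≤s⁻¹)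
open import Data.Nat.Properties hiding (_≟_)
open import Data.Nat.Tactic.RingSolver using (solve)
open import Data.Nat.DivMod using (_%_; [m+n]%n≡m%n; m<n⇒m%n≡m)
open import Algebra.Properties.CommutativeSemigroup +-commutativeSemigroup
  using (x∙yz≈y∙xz; xy∙z≈y∙xz; xy∙z≈yz∙x; xy∙z≈zx∙y)
open import Data.Fin using (Fin; toℕ; fromℕ; fromℕ<) renaming (zero to fz; suc to fs)
open import Data.Fin.Properties using (_≟_; any?; toℕ<n; toℕ-injective; toℕ-fromℕ; toℕ-fromℕ<)
import Data.Fin.Properties as Finₚ
open import Data.Bool using (Bool; true; false; not; if_then_else_)
import Data.Bool.Properties as Boolₚ
open import Data.List using (_∷_; [])
open import Data.Product using (Σ; ∃-syntax; _×_; _,_; proj₁; proj₂)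
open import Data.Sum using (_⊎_; inj₁; inj₂; map₂)
open import Data.Empty using (⊥; ⊥-elim)
open import Function using (_∘_; mk⇔)
open import Relation.Nullary using (¬_; Dec; does; yes; no)
open import Relation.Nullary.Decidable using (dec-true; dec-false; does-⇔; _×-dec_; _⊎-dec_)
open import Relation.Binary.PropositionalEquality
open import Relation.Binary.Definitions using (tri<; tri≈; tri>)

true≢false : true ≢ false
true≢false ()

neither-half : ∀ {A : Set} (f : Bool → A) b → f b ≢ f false → f b ≢ f true → ⊥
neither-half f false ≢f _ = ≢f refl
neither-half f true  _ ≢t = ≢t refl

does-true⇒ : ∀ {a} {A : Set a} (a? : Dec A) → does a? ≡ true → A
does-true⇒ (yes a) _ = a

does-<-step : ∀ {a j} → a ≢ j → does (a <? j) ≡ does (a <? suc j)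
does-<-step {a} {j} a≢j =
  does-⇔ (mk⇔ m<n⇒m<1+n (λ a<j+1 → ≤∧≢⇒< (s≤s⁻¹ a<j+1) a≢j)) (a <? j) (a <? suc j)

-- Flips and walks

module _ {n : ℕ} where

  infix 4 _≐_
  _≐_ : ChordSet n → ChordSet n → Set
  A ≐ B = ∀ c → A c ≡ B c

  cspt-resp : {A B : ChordSet n} → A ≐ B → CSPT B → CSPT A
  cspt-resp A≐B (crossingFree , maximal , symmetric) =
    (λ c d Ac Ad → crossingFree c d (trans (sym (A≐B c)) Ac) (trans (sym (A≐B d)) Ad)) ,
    (λ c uncrossed → trans (A≐B c) (maximal c (λ d Bd → uncrossed d (trans (A≐B d) Bd)))) ,
    (λ c Ac → trans (A≐B (symC c)) (symmetric c (trans (sym (A≐B c)) Ac)))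

  flip-respˡ : {A B C : ChordSet n} → A ≐ B → Flip B C → Flip A C
  flip-respˡ A≐B (B-cspt , C-cspt , c , c′ , Bc , Cc , Cc′ , Bc′ , unchanged) =
    cspt-resp A≐B B-cspt , C-cspt , c , c′ , trans (A≐B c) Bc , Cc , Cc′ , trans (A≐B c′) Bc′ ,
    λ d d≢c d≢c̄ d≢c′ d≢c̄′ → trans (A≐B d) (unchanged d d≢c d≢c̄ d≢c′ d≢c̄′)

  flip-sym : {A B : ChordSet n} → Flip A B → Flip B A
  flip-sym (A-cspt , B-cspt , c , c′ , Ac , Bc , Bc′ , Ac′ , unchanged) =
    B-cspt , A-cspt , c′ , c , Bc′ , Ac′ , Ac , Bc ,
    λ d d≢c′ d≢c̄′ d≢c d≢c̄ → sym (unchanged d d≢c d≢c̄ d≢c′ d≢c̄′)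

  -- A chord of A outside the removed pair that is missing from B would have to be
  -- one of the inserted pair, which B contains.
  flip-keeps : {A B : ChordSet n} → Flip A B →
               Σ (Chord n) λ c → ∀ d → d ≢ c → d ≢ symC c → A d ≡ true → B d ≡ true
  flip-keeps {A} {B} (_ , (_ , _ , B-symmetric) , c , c′ , _ , _ , Bc′ , _ , unchanged) = c , keeps
    where
    keeps : ∀ d → d ≢ c → d ≢ symC c → A d ≡ true → B d ≡ true
    keeps d d≢c d≢c̄ Ad with B d in Bd
    ... | true  = refl
    ... | false =
      ⊥-elim (true≢false (trans (sym Ad) (trans (unchanged d d≢c d≢c̄ d≢c′ d≢c̄′) Bd)))
      where
      d≢c′ : d ≢ c′
      d≢c′ refl = true≢false (trans (sym Bc′) Bd)
      d≢c̄′ : d ≢ symC c′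
      d≢c̄′ refl = true≢false (trans (sym (B-symmetric c′ Bc′)) Bd)

  cen-pair-index : ∀ {s X : Side} {q q′ : Fin n} {b} →
                   cen X (q′ , b) ≢ cen s (q , false) → cen X (q′ , b) ≢ cen s (q , true) →
                   X ≡ s → q′ ≢ q
  cen-pair-index {s} {q = q} {b = b} ≢c ≢c̄ refl refl =
    neither-half (λ b′ → cen s (q , b′)) b ≢c ≢c̄

  diag-pair-index : ∀ {p p′ : Fin n} {k k′ : Fin (n ∸ 2)} {b} →
                    diag (p′ , b) k′ ≢ diag (p , false) k → diag (p′ , b) k′ ≢ diag (p , true) k →
                    p′ ≡ p → k′ ≢ k
  diag-pair-index {p} {k = k} {b = b} ≢c ≢c̄ refl refl =
    neither-half (λ b′ → diag (p , b′) k) b ≢c ≢c̄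

  walk-respˡ : {A A′ B : ChordSet n} {k : ℕ} → A ≐ A′ → Walk A′ B k → Walk A B k
  walk-respˡ A≐A′ (here A′≐B) = here (λ c → trans (A≐A′ c) (A′≐B c))
  walk-respˡ A≐A′ (step f w)  = step (flip-respˡ A≐A′ f) w

  walk-respʳ : {A B B′ : ChordSet n} {k : ℕ} → Walk A B k → B ≐ B′ → Walk A B′ k
  walk-respʳ (here A≐B)  B≐B′ = here (λ c → trans (A≐B c) (B≐B′ c))
  walk-respʳ (step f w) B≐B′ = step f (walk-respʳ w B≐B′)

  walk-snoc : {A B C : ChordSet n} {k : ℕ} → Walk A B k → Flip B C → Walk A C (suc k)
  walk-snoc (here A≐B) f  = step (flip-respˡ A≐B f) (here λ _ → refl)
  walk-snoc (step f w) f′ = step f (walk-snoc w f′)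

  walk-++ : {A B C : ChordSet n} {k l : ℕ} → Walk A B k → Walk B C l → Walk A C (k + l)
  walk-++ (here A≐B) w  = walk-respˡ A≐B w
  walk-++ (step f w) w′ = step f (walk-++ w w′)

  walk-sym : {A B : ChordSet n} {k : ℕ} → Walk A B k → Walk B A k
  walk-sym (here A≐B) = here (λ c → sym (A≐B c))
  walk-sym (step f w) = walk-snoc (walk-sym w) (flip-sym f)

  walk-chain : (F : ℕ → ChordSet n) (k : ℕ) →
               (∀ j → j < k → Flip (F j) (F (suc j))) → Walk (F 0) (F k) k
  walk-chain F zero    _     = here (λ _ → refl)
  walk-chain F (suc k) flips =
    walk-snoc (walk-chain F k (λ j j<k → flips j (m<n⇒m<1+n j<k))) (flips k ≤-refl)

private
  telescope : ∀ x y z x′ y′ z′ k → x + y′ ≤ suc (y + x′) → y + z′ ≤ k + (z + y′) →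
              x + z′ ≤ suc k + (z + x′)
  telescope x y z x′ y′ z′ k h₁ h₂ = +-cancelʳ-≤ (y + y′) _ _ (begin
    (x + z′) + (y + y′)          ≡⟨ solve (x ∷ y ∷ y′ ∷ z′ ∷ []) ⟩
    (x + y′) + (y + z′)          ≤⟨ +-mono-≤ h₁ h₂ ⟩
    suc (y + x′) + (k + (z + y′)) ≡⟨ solve (x′ ∷ y ∷ y′ ∷ z ∷ k ∷ []) ⟩
    (suc k + (z + x′)) + (y + y′) ∎)
    where open ≤-Reasoning

-- Read as: f − g drops by at most one per flip, hence by at most k along a walk of length k
-- (both sides moved so that no subtraction occurs).
walk-potential : {n : ℕ} (f g : ChordSet n → ℕ) →
                 (∀ {A B} → A ≐ B → f A ≡ f B) → (∀ {A B} → A ≐ B → g A ≡ g B) →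
                 (∀ {A B} → Flip A B → f A + g B ≤ suc (f B + g A)) →
                 ∀ {A B k} → Walk A B k → f A + g B ≤ k + (f B + g A)
walk-potential f g f-cong g-cong flip-step (here A≐B) =
  ≤-reflexive (cong₂ _+_ (f-cong A≐B) (sym (g-cong A≐B)))
walk-potential f g f-cong g-cong flip-step {A} {B} (step {C = C} {k = k} flip w) =
  telescope (f A) (f C) (f B) (g A) (g C) (g B) k
    (flip-step flip) (walk-potential f g f-cong g-cong flip-step w)

-- Counting

count : ∀ {k} → (Fin k → Bool) → ℕ
count {zero}  f = 0
count {suc k} f = if f fz then suc (count (f ∘ fs)) else count (f ∘ fs)

count-cong : ∀ {k} {f g : Fin k → Bool} → (∀ i → f i ≡ g i) → count f ≡ count g
count-cong {zero}          f≗g = refl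
count-cong {suc k} {f} {g} f≗g rewrite f≗g fz =
  cong (λ c → if g fz then suc c else c) (count-cong (f≗g ∘ fs))

count-head-≤ : ∀ {k} (f g : Fin (suc k) → Bool) d → (f fz ≡ true → g fz ≡ true) →
               count (f ∘ fs) ≤ d + count (g ∘ fs) → count f ≤ d + count g
count-head-≤ f g d f₀⇒g₀ tail≤ with f fz | g fz
... | true  | true  = ≤-trans (s≤s tail≤) (≤-reflexive (sym (+-suc d _)))
... | false | true  = ≤-trans tail≤ (+-monoʳ-≤ d (n≤1+n _))
... | false | false = tail≤
... | true  | false = ⊥-elim (true≢false (sym (f₀⇒g₀ refl)))

count-mono : ∀ {k} {f g : Fin k → Bool} → (∀ i → f i ≡ true → g i ≡ true) → count f ≤ count g
count-mono {zero}  f⊆g = z≤n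
count-mono {suc k} {f} {g} f⊆g = count-head-≤ f g 0 (f⊆g fz) (count-mono (f⊆g ∘ fs))

count-≤-suc : ∀ {k} {f g : Fin k → Bool} (i₀ : Fin k) →
              (∀ i → i ≢ i₀ → f i ≡ true → g i ≡ true) → count f ≤ suc (count g)
count-≤-suc {suc k} {f} {g} fz f⊆g = begin
  count f              ≤⟨ count-≤-suc-tail ⟩
  suc (count (f ∘ fs)) ≤⟨ s≤s (count-mono (λ i → f⊆g (fs i) λ ())) ⟩
  suc (count (g ∘ fs)) ≤⟨ s≤s count-tail-≤ ⟩
  suc (count g)        ∎
  where
  open ≤-Reasoning
  count-≤-suc-tail : count f ≤ suc (count (f ∘ fs))
  count-≤-suc-tail with f fz
  ... | true  = ≤-refl
  ... | false = n≤1+n _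
  count-tail-≤ : count (g ∘ fs) ≤ count g
  count-tail-≤ with g fz
  ... | true  = n≤1+n _
  ... | false = ≤-refl
count-≤-suc {suc k} {f} {g} (fs j) f⊆g =
  count-head-≤ f g 1 (f⊆g fz λ ())
    (count-≤-suc j (λ i i≢j → f⊆g (fs i) (i≢j ∘ Finₚ.suc-injective)))

count-true : ∀ k → count {k} (λ _ → true) ≡ k
count-true zero    = refl
count-true (suc k) = cong suc (count-true k)

count-false : ∀ k → count {k} (λ _ → false) ≡ 0
count-false zero    = refl
count-false (suc k) = count-false k

count-≤-1 : ∀ {k} {f : Fin k → Bool} (i₀ : Fin k) → (∀ i → f i ≡ true → i ≡ i₀) → count f ≤ 1
count-≤-1 {k} {f} i₀ only-i₀ = begin
  count f                       ≤⟨ count-≤-suc i₀ (λ i i≢i₀ fi → ⊥-elim (i≢i₀ (only-i₀ i fi))) ⟩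
  suc (count {k} (λ _ → false)) ≡⟨ cong suc (count-false k) ⟩
  1                             ∎
  where open ≤-Reasoning

count-≡0 : ∀ {k} {f : Fin k → Bool} → (∀ i → f i ≢ true) → count f ≡ 0
count-≡0 {k} {f} none = n≤0⇒n≡0 (begin
  count f                 ≤⟨ count-mono (λ i fi → ⊥-elim (none i fi)) ⟩
  count {k} (λ _ → false) ≡⟨ count-false k ⟩
  0                       ∎)
  where open ≤-Reasoning

pred-potential-step : ∀ {a a′ b b′} → a ≤ suc a′ → b′ ≤ suc b → a ≤ 1 ⊎ b ≡ 0 →
                      (a ∸ 1) + (b′ ∸ 1) ≤ suc ((a′ ∸ 1) + (b ∸ 1))
pred-potential-step {a} {a′} {b} {b′} a≤ b′≤ (inj₁ a≤1) = begin
  (a ∸ 1) + (b′ ∸ 1)      ≡⟨ cong (_+ (b′ ∸ 1)) (n≤0⇒n≡0 (∸-monoˡ-≤ 1 a≤1)) ⟩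
  b′ ∸ 1                  ≤⟨ ∸-monoˡ-≤ 1 b′≤ ⟩
  b                       ≤⟨ m≤n+m∸n b 1 ⟩
  suc (b ∸ 1)             ≤⟨ s≤s (m≤n+m _ _) ⟩
  suc ((a′ ∸ 1) + (b ∸ 1)) ∎
  where open ≤-Reasoning
pred-potential-step {a} {a′} {b′ = b′} a≤ b′≤ (inj₂ refl) = begin
  (a ∸ 1) + (b′ ∸ 1)      ≡⟨ cong ((a ∸ 1) +_) (n≤0⇒n≡0 (∸-monoˡ-≤ 1 b′≤)) ⟩
  (a ∸ 1) + 0             ≡⟨ +-identityʳ _ ⟩
  a ∸ 1                   ≤⟨ ∸-monoˡ-≤ 1 a≤ ⟩
  a′                      ≤⟨ m≤n+m∸n a′ 1 ⟩
  suc (a′ ∸ 1)            ≡⟨ cong suc (sym (+-identityʳ _)) ⟩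
  suc ((a′ ∸ 1) + 0)      ∎
  where open ≤-Reasoning

-- The 2n-gon

module Polygon (m : ℕ) where

  n : ℕ
  n = suc (suc m)

  N : ℕ
  N = n + n

  n<N : n < N
  n<N = m<m+n n z<s

  pos≤N : ∀ v → pos {n} v ≤ N
  pos≤N (p , false) = ≤-trans (<⇒≤ (toℕ<n p)) (m≤m+n n n)
  pos≤N (p , true)  = +-monoʳ-≤ n (<⇒≤ (toℕ<n p))

  offset-no-wrap : ∀ a x {d} → a ≤ N → d < N → x ≡ a + d → offset n a x ≡ d
  offset-no-wrap a x {d} a≤N d<N refl = begin
    (a + d + (N ∸ a)) % N ≡⟨ cong (_% N) shifted ⟩
    (d + N) % N           ≡⟨ [m+n]%n≡m%n d N ⟩
    d % N                 ≡⟨ m<n⇒m%n≡m d<N ⟩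
    d                     ∎
    where
    open ≡-Reasoning
    shifted : a + d + (N ∸ a) ≡ d + N
    shifted = trans (xy∙z≈y∙xz a d _) (cong (d +_) (m+[n∸m]≡n a≤N))

  offset-wrap : ∀ a x {d} → a ≤ N → d < N → x + N ≡ a + d → offset n a x ≡ d
  offset-wrap a x {d} a≤N d<N x+N≡a+d = begin
    (x + (N ∸ a)) % N ≡⟨ cong (_% N) (+-cancelˡ-≡ a _ _ shifted) ⟩
    d % N             ≡⟨ m<n⇒m%n≡m d<N ⟩
    d                 ∎
    where
    open ≡-Reasoning
    shifted : a + (x + (N ∸ a)) ≡ a + d
    shifted = trans (x∙yz≈y∙xz a x _) (trans (cong (x +_) (m+[n∸m]≡n a≤N)) x+N≡a+d)

  offset-same-half-shifted : ∀ b (p r : Fin n) e d → toℕ r + e ≡ toℕ p + d → d < N →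
                             offset n (pos (p , b)) (pos (r , b) + e) ≡ d
  offset-same-half-shifted false p r e d eq d<N =
    offset-no-wrap (toℕ p) (toℕ r + e) (pos≤N (p , false)) d<N eq
  offset-same-half-shifted true p r e d eq d<N =
    offset-no-wrap (n + toℕ p) (n + toℕ r + e) (pos≤N (p , true)) d<N (begin
    n + toℕ r + e   ≡⟨ +-assoc n (toℕ r) e ⟩
    n + (toℕ r + e) ≡⟨ cong (n +_) eq ⟩
    n + (toℕ p + d) ≡⟨ +-assoc n (toℕ p) d ⟨
    n + toℕ p + d   ∎)
    where open ≡-Reasoning

  offset-opposite-half-shifted : ∀ b (p r : Fin n) e d → toℕ r + e + n ≡ toℕ p + d → d < N →
                                 offset n (pos (p , b)) (pos (r , not b) + e) ≡ d
  offset-opposite-half-shifted false p r e d eq d<N =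
    offset-no-wrap (toℕ p) (n + toℕ r + e) (pos≤N (p , false)) d<N (begin
    n + toℕ r + e   ≡⟨ xy∙z≈yz∙x n (toℕ r) e ⟩
    toℕ r + e + n   ≡⟨ eq ⟩
    toℕ p + d       ∎)
    where open ≡-Reasoning
  offset-opposite-half-shifted true p r e d eq d<N =
    offset-wrap (n + toℕ p) (toℕ r + e) (pos≤N (p , true)) d<N (begin
    toℕ r + e + (n + n) ≡⟨ +-assoc (toℕ r + e) n n ⟨
    toℕ r + e + n + n   ≡⟨ cong (_+ n) eq ⟩
    toℕ p + d + n       ≡⟨ xy∙z≈zx∙y (toℕ p) d n ⟩
    n + toℕ p + d       ∎)
    where open ≡-Reasoning

  offset-same-half : ∀ b (p r : Fin n) d → toℕ r ≡ toℕ p + d → d < N →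
                     offset n (pos (p , b)) (pos (r , b)) ≡ d
  offset-same-half b p r d eq d<N =
    trans (cong (offset n (pos (p , b))) (sym (+-identityʳ (pos (r , b)))))
          (offset-same-half-shifted b p r 0 d (trans (+-identityʳ (toℕ r)) eq) d<N)

  offset-opposite-half : ∀ b (p r : Fin n) d → toℕ r + n ≡ toℕ p + d → d < N →
                         offset n (pos (p , b)) (pos (r , not b)) ≡ d
  offset-opposite-half b p r d eq d<N =
    trans (cong (offset n (pos (p , b))) (sym (+-identityʳ (pos (r , not b)))))
          (offset-opposite-half-shifted b p r 0 d (trans (cong (_+ n) (+-identityʳ (toℕ r))) eq) d<N)

  offset-same-half-wrap : ∀ b (p r : Fin n) d → toℕ r + N ≡ toℕ p + d → d < N →
                          offset n (pos (p , b)) (pos (r , b)) ≡ d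
  offset-same-half-wrap false p r d eq d<N =
    offset-wrap (toℕ p) (toℕ r) (pos≤N (p , false)) d<N eq
  offset-same-half-wrap true p r d eq d<N =
    offset-wrap (n + toℕ p) (n + toℕ r) (pos≤N (p , true)) d<N (begin
    n + toℕ r + N   ≡⟨ +-assoc n (toℕ r) N ⟩
    n + (toℕ r + N) ≡⟨ cong (n +_) eq ⟩
    n + (toℕ p + d) ≡⟨ +-assoc n (toℕ p) d ⟨
    n + toℕ p + d   ∎)
    where open ≡-Reasoning

  inside-at : ∀ (v : Vertex n) k x {d} → offset n (pos v) x ≡ d →
              0 < d → d < len n k → Inside v k x
  inside-at v k x refl 0<d d<len = 0<d , d<len

  not-inside-at : ∀ (v : Vertex n) k x {d} → offset n (pos v) x ≡ d →
                  d ≡ 0 ⊎ len n k ≤ d → ¬ Inside v k x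
  not-inside-at v k x refl (inj₁ d≡0) (0<d , _) = <-irrefl (sym d≡0) 0<d
  not-inside-at v k x refl (inj₂ len≤d) (_ , d<len) = <⇒≱ d<len len≤d

  ccwHalf-at : ∀ (v w : Vertex n) {d} → offset n (pos v) (pos w) ≡ d →
               0 < d → d < n → CCWHalf v w
  ccwHalf-at v w refl 0<d d<n = 0<d , d<n

  -- Lower bound

  cenL-cenR-index : ∀ {T : ChordSet n} {p r} → CSPT T →
                    T (cen L (p , false)) ≡ true → T (cen R (r , false)) ≡ true → p ≡ r
  cenL-cenR-index {T} {p} {r} (crossingFree , _ , symmetric) Tpᴸ Trᴿ with <-cmp (toℕ p) (toℕ r)
  ... | tri≈ _ p≡r _ = toℕ-injective p≡r
  ... | tri< p<r _ _ = ⊥-elim (crossingFree _ _ Tpᴸ Trᴿ (ccwHalf-at (p , false) (r , false)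
          (offset-same-half false p r _ (sym (m+[n∸m]≡n (<⇒≤ p<r))) (<-trans r∸p<n n<N))
          (m<n⇒0<n∸m p<r) r∸p<n))
    where
    r∸p<n : toℕ r ∸ toℕ p < n
    r∸p<n = ≤-<-trans (m∸n≤m (toℕ r) (toℕ p)) (toℕ<n r)
  ... | tri> _ _ r<p = ⊥-elim (crossingFree _ _ (symmetric _ Tpᴸ) Trᴿ (ccwHalf-at (p , true) (r , false)
          (offset-opposite-half true p r _ (sym (m+[n∸m]≡n p≤r+n)) (<-trans d<n n<N))
          (m<n⇒0<n∸m (<-≤-trans (toℕ<n p) (m≤n+m n (toℕ r)))) d<n))
    where
    p≤r+n : toℕ p ≤ toℕ r + n
    p≤r+n = ≤-trans (<⇒≤ (toℕ<n p)) (m≤n+m n (toℕ r))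
    d<n : toℕ r + n ∸ toℕ p < n
    d<n = subst (toℕ r + n ∸ toℕ p <_) (m+n∸m≡n (toℕ p) n) (∸-monoˡ-< (+-monoˡ-< n r<p) p≤r+n)

  sideCount : Side → ChordSet n → ℕ
  sideCount s T = count (λ p → T (cen s (p , false)))

  index : Chord n → Fin n
  index (diag (p , _) _) = p
  index (cen _ (p , _))  = p

  index-symC : ∀ c → index (symC c) ≡ index c
  index-symC (diag _ _) = refl
  index-symC (cen _ _)  = refl

  sideCount-flip : ∀ s {A B} → Flip A B → sideCount s A ≤ suc (sideCount s B)
  sideCount-flip s f with flip-keeps f
  ... | c , keeps = count-≤-suc (index c) λ i i≢c → keeps (cen s (i , false))
    (λ eq → i≢c (cong index eq)) (λ eq → i≢c (trans (cong index eq) (index-symC c)))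

  sideCountL≤1⊎sideCountR≡0 : ∀ {T} → CSPT T → sideCount L T ≤ 1 ⊎ sideCount R T ≡ 0
  sideCountL≤1⊎sideCountR≡0 {T} cspt with any? (λ r → T (cen R (r , false)) Boolₚ.≟ true)
  ... | yes (r , Trᴿ) = inj₁ (count-≤-1 r (λ p Tpᴸ → cenL-cenR-index cspt Tpᴸ Trᴿ))
  ... | no  none      = inj₂ (count-≡0 (λ r Trᴿ → none (r , Trᴿ)))

  sideExcess : Side → ChordSet n → ℕ
  sideExcess s T = sideCount s T ∸ 1

  sideExcess-flip : ∀ {A B} → Flip A B →
                    sideExcess L A + sideExcess R B ≤ suc (sideExcess L B + sideExcess R A)
  sideExcess-flip f = pred-potential-step
    (sideCount-flip L f) (sideCount-flip R (flip-sym f)) (sideCountL≤1⊎sideCountR≡0 (proj₁ f))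

  sideExcess-cong : ∀ s {A B} → A ≐ B → sideExcess s A ≡ sideExcess s B
  sideExcess-cong s A≐B = cong (_∸ 1) (count-cong (λ p → A≐B (cen s (p , false))))

  flip-distance-lower : ∀ {k} → Walk (leftStar n) (rightStar n) k → 2 * n ∸ 2 ≤ k
  flip-distance-lower {k} w = begin
    2 * n ∸ 2
      ≡⟨⟩
    m + (2 + m + 0)
      ≡⟨ solve (m ∷ []) ⟩
    suc m + suc m
      ≡⟨ cong₂ (λ a b → (a ∸ 1) + (b ∸ 1)) (count-true n) (count-true n) ⟨
    sideExcess L (leftStar n) + sideExcess R (rightStar n)
      ≤⟨ walk-potential (sideExcess L) (sideExcess R)
           (sideExcess-cong L) (sideExcess-cong R) sideExcess-flip w ⟩
    k + (sideExcess L (rightStar n) + sideExcess R (leftStar n))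
      ≡⟨ cong₂ (λ a b → k + ((a ∸ 1) + (b ∸ 1))) (count-false n) (count-false n) ⟩
    k + 0
      ≡⟨ +-identityʳ k ⟩
    k ∎
    where open ≤-Reasoning

  -- Fans

  -- the diagonals 0–2, …, 0–(j+1), their mirror images from 0̄, and the central chords given by c
  fan : ℕ → (Side → Fin n → Bool) → ChordSet n
  fan j c (diag (p , _) k) = does (p ≟ fz ×-dec toℕ k <? j)
  fan j c (cen s (p , _))  = c s p

  -- neither q nor q̄ lies strictly under a diagonal of fan j
  Free : ℕ → Fin n → Set
  Free j q = q ≡ fz ⊎ j < toℕ q

  free? : ∀ j q → Dec (Free j q)
  free? j q = q ≟ fz ⊎-dec j <? toℕ q

  fan-symmetric : ∀ j c → CentrallySymmetric (fan j c)
  fan-symmetric j c (diag _ _) present = present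
  fan-symmetric j c (cen _ _)  present = present

  fan-diagonal : ∀ {j c} b (k : Fin m) → toℕ k < j → fan j c (diag (fz , b) k) ≡ true
  fan-diagonal {j} b k k<j = dec-true (fz {suc m} ≟ fz ×-dec toℕ k <? j) (refl , k<j)

  data Relative (b : Bool) : Bool → Set where
    same     : Relative b b
    opposite : Relative b (not b)

  relative : ∀ b b′ → Relative b b′
  relative false false = same
  relative false true  = opposite
  relative true  false = opposite
  relative true  true  = same

  len<n : (k : Fin m) → len n k < n
  len<n k = s≤s (s≤s (toℕ<n k))

  offset-from-zero : ∀ b q → offset n (pos (fz , b)) (pos (q , b)) ≡ toℕ q
  offset-from-zero b q = offset-same-half b fz q (toℕ q) refl (<-trans (toℕ<n q) n<N)

  offset-from-zero-opposite : ∀ b q → offset n (pos (fz , b)) (pos (q , not b)) ≡ toℕ q + n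
  offset-from-zero-opposite b q = offset-opposite-half b fz q (toℕ q + n) refl (+-monoˡ-< n (toℕ<n q))

  fan-diagonal-avoids-free : ∀ {j q} b b′ (k : Fin m) → toℕ k < j → Free j q →
                             ¬ Inside (fz , b) k (pos (q , b′))
  fan-diagonal-avoids-free {j} {q} b b′ k k<j free with relative b b′ | free
  ... | same     | inj₁ refl = not-inside-at (fz , b) k (pos (fz , b)) (offset-from-zero b fz) (inj₁ refl)
  ... | same     | inj₂ j<q  = not-inside-at (fz , b) k (pos (q , b)) (offset-from-zero b q)
                                 (inj₂ (≤-trans (s≤s k<j) j<q))
  ... | opposite | _         = not-inside-at (fz , b) k (pos (q , not b)) (offset-from-zero-opposite b q)
                                 (inj₂ (≤-trans (<⇒≤ (len<n k)) (m≤n+m n (toℕ q))))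

  fan-diagonals-noncrossing : ∀ b b′ (k k′ : Fin m) → ¬ Cross (diag (fz , b) k) (diag (fz , b′) k′)
  fan-diagonals-noncrossing b b′ k k′ crosses with relative b b′ | crosses
  ... | same | inj₁ (inside , _) =
    not-inside-at (fz , b) k (pos (fz , b)) (offset-from-zero b fz) (inj₁ refl) inside
  ... | same | inj₂ (_ , outside) = n≮0 (subst (len n k <_) (offset-from-zero b fz) outside)
  ... | opposite | inj₁ (inside , _) =
    not-inside-at (fz , b) k (pos (fz , not b)) (offset-from-zero-opposite b fz)
      (inj₂ (<⇒≤ (len<n k))) inside
  ... | opposite | inj₂ (inside , _) =
    not-inside-at (fz , b) k (pos (fz , not b) + len n k′)
      (offset-opposite-half-shifted b fz fz (len n k′) (len n k′ + n) refl (+-monoˡ-< n (len<n k′)))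
      (inj₂ (≤-trans (<⇒≤ (len<n k)) (m≤n+m n (len n k′)))) inside

  CrossedBy : ChordSet n → Chord n → Set
  CrossedBy T d = ∃[ d′ ] T d′ ≡ true × Cross d d′

  record Admissible (j : ℕ) (c : Side → Fin n → Bool) : Set where
    field
      bounded                : j ≤ m
      central-free           : ∀ X q → c X q ≡ true → Free j q
      left-right-noncrossing : ∀ v w → c L (proj₁ v) ≡ true → c R (proj₁ w) ≡ true → ¬ CCWHalf v w
      central-blocked        : ∀ X q b → c X q ≡ false → Free j q → CrossedBy (fan j c) (cen X (q , b))
      zero-central           : ∃[ X ] c X fz ≡ true
      free-central           : j < m → ∀ q → j < toℕ q → ∃[ X ] c X q ≡ true

  module FanCSPT {j : ℕ} {c : Side → Fin n → Bool} (admissible : Admissible j c) where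
    open Admissible admissible

    Crossed : Chord n → Set
    Crossed = CrossedBy (fan j c)

    crossingFree : CrossingFree (fan j c)
    crossingFree (diag (p , b) k) (diag (p′ , b′) k′) present present′
      with does-true⇒ (p ≟ fz ×-dec toℕ k <? j) present
         | does-true⇒ (p′ ≟ fz ×-dec toℕ k′ <? j) present′
    ... | refl , _ | refl , _ = fan-diagonals-noncrossing b b′ k k′
    crossingFree (diag (p , b) k) (cen X (q , b′)) present present′
      with does-true⇒ (p ≟ fz ×-dec toℕ k <? j) present
    ... | refl , k<j = fan-diagonal-avoids-free b b′ k k<j (central-free X q present′)
    crossingFree (cen X (q , b′)) (diag (p , b) k) present′ present
      with does-true⇒ (p ≟ fz ×-dec toℕ k <? j) present
    ... | refl , k<j = fan-diagonal-avoids-free b b′ k k<j (central-free X q present′)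
    crossingFree (cen L _) (cen L _) _ _ ()
    crossingFree (cen R _) (cen R _) _ _ ()
    crossingFree (cen L v) (cen R w) cv cw = left-right-noncrossing v w cv cw
    crossingFree (cen R w) (cen L v) cw cv = left-right-noncrossing v w cv cw

    central-under-fan-crossed : ∀ X b q → suc (toℕ q) ≤ j → Crossed (cen X (fs q , b))
    central-under-fan-crossed X b q q<j =
      diag (fz , b) k , fan-diagonal {c = c} b k (subst (_< j) (sym k≡q) q<j) ,
      inside-at (fz , b) k (pos (fs q , b)) (offset-from-zero b (fs q)) z<s
        (subst (λ x → suc (toℕ q) < 2 + x) (sym k≡q) ≤-refl)
      where
      q<m : toℕ q < m
      q<m = <-≤-trans q<j bounded
      k : Fin m
      k = fromℕ< q<m
      k≡q : toℕ k ≡ toℕ q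
      k≡q = toℕ-fromℕ< q<m

    -- such a diagonal separates 0̄ from the disk, so it crosses the central chords at 0̄
    long-diagonal-crossed : ∀ p b k → n < toℕ p + len n k → Crossed (diag (p , b) k)
    long-diagonal-crossed p b k long =
      cen (proj₁ zero-central) (fz , not b) , proj₂ zero-central ,
      inside-at (p , b) k (pos (fz , not b))
        (offset-opposite-half b p fz (n ∸ toℕ p) (sym (m+[n∸m]≡n (<⇒≤ (toℕ<n p))))
          (≤-<-trans (m∸n≤m n (toℕ p)) n<N))
        (m<n⇒0<n∸m (toℕ<n p)) (m<n+o⇒m∸n<o n (toℕ p) long)

    short-diagonal-from-zero-crossed : ∀ b k → ¬ toℕ k < j → len n k ≤ n → Crossed (diag (fz , b) k)
    short-diagonal-from-zero-crossed b k k≮j short =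
      cen (proj₁ central) (q , b) , proj₂ central ,
      inside-at (fz , b) k (pos (q , b)) (trans (offset-from-zero b q) (toℕ-fromℕ< short)) z<s ≤-refl
      where
      q : Fin n
      q = fromℕ< short
      central : ∃[ X ] c X q ≡ true
      central = free-central (≤-<-trans (≮⇒≥ k≮j) (toℕ<n k)) q
                  (subst (j <_) (sym (toℕ-fromℕ< short)) (s≤s (≮⇒≥ k≮j)))

    -- the fan diagonal 0–(p+2) has p+2 strictly inside this diagonal and 0 strictly outside
    short-diagonal-crossed-by-fan : ∀ b p k → suc (toℕ p) ≤ j → suc (toℕ p) + len n k ≤ n →
                                    Crossed (diag (fs p , b) k)
    short-diagonal-crossed-by-fan b p k p<j short =
      diag (fz , b) kp , fan-diagonal {c = c} b kp (subst (_< j) (sym kp≡p) p<j) ,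
      inj₂ (inside-at (fs p , b) k (pos (fz , b) + len n kp) just-after z<s (s<s z<s) ,
            subst (len n k <_) (sym wrap) beyond)
      where
      p<m : toℕ p < m
      p<m = <-≤-trans p<j bounded
      kp : Fin m
      kp = fromℕ< p<m
      kp≡p : toℕ kp ≡ toℕ p
      kp≡p = toℕ-fromℕ< p<m
      just-after : offset n (pos (fs p , b)) (pos (fz , b) + len n kp) ≡ 1
      just-after = offset-same-half-shifted b (fs p) fz (len n kp) 1
                     (trans (cong (2 +_) kp≡p) (sym (+-comm (suc (toℕ p)) 1))) (s<s z<s)
      p+1≤N : suc (toℕ p) ≤ N
      p+1≤N = <⇒≤ (<-trans (toℕ<n (fs p)) n<N)
      wrap : offset n (pos (fs p , b)) (pos (fz , b)) ≡ N ∸ suc (toℕ p)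
      wrap = offset-same-half-wrap b (fs p) fz (N ∸ suc (toℕ p)) (sym (m+[n∸m]≡n p+1≤N))
               (∸-monoʳ-< z<s p+1≤N)
      beyond : len n k < N ∸ suc (toℕ p)
      beyond = m+n≤o⇒m≤o∸n (suc (len n k))
                 (≤-trans (s≤s (subst (_≤ n) (+-comm (suc (toℕ p)) (len n k)) short)) n<N)

    short-diagonal-crossed-by-central : ∀ b p k → j < suc (toℕ p) → suc (toℕ p) + len n k ≤ n →
                                        Crossed (diag (fs p , b) k)
    short-diagonal-crossed-by-central b p k j<p short =
      cen (proj₁ central) (q , b) , proj₂ central ,
      inside-at (fs p , b) k (pos (q , b))
        (offset-same-half b (fs p) q 1 (trans (toℕ-fromℕ< q<n) (sym (+-comm (suc (toℕ p)) 1)))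
          (s<s z<s))
        z<s (s<s z<s)
      where
      q<n : suc (suc (toℕ p)) < n
      q<n = subst (_≤ n) (+-comm (suc (toℕ p)) 2)
              (≤-trans (+-monoʳ-≤ (suc (toℕ p)) (s≤s (s≤s z≤n))) short)
      q : Fin n
      q = fromℕ< q<n
      central : ∃[ X ] c X q ≡ true
      central = free-central (<-≤-trans j<p (s≤s⁻¹ (s≤s⁻¹ q<n))) q
                  (subst (j <_) (sym (toℕ-fromℕ< q<n)) (m<n⇒m<1+n j<p))

    absent-crossed : ∀ d → fan j c d ≡ false → Crossed d
    absent-crossed (cen X (fz , b)) absent = central-blocked X fz b absent (inj₁ refl)
    absent-crossed (cen X (fs q , b)) absent with j <? suc (toℕ q)
    ... | yes j<q = central-blocked X (fs q) b absent (inj₂ j<q)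
    ... | no  j≮q = central-under-fan-crossed X b q (≮⇒≥ j≮q)
    absent-crossed (diag (fz , b) k) absent with n <? len n k
    ... | yes long  = long-diagonal-crossed fz b k long
    ... | no  short = short-diagonal-from-zero-crossed b k k≮j (≮⇒≥ short)
      where
      k≮j : ¬ toℕ k < j
      k≮j k<j = true≢false (trans (sym (fan-diagonal {c = c} b k k<j)) absent)
    absent-crossed (diag (fs p , b) k) absent with n <? suc (toℕ p) + len n k | j <? suc (toℕ p)
    ... | yes long  | _       = long-diagonal-crossed (fs p) b k long
    ... | no  short | yes j<p = short-diagonal-crossed-by-central b p k j<p (≮⇒≥ short)
    ... | no  short | no  j≮p = short-diagonal-crossed-by-fan b p k (≮⇒≥ j≮p) (≮⇒≥ short)

    maximal : Maximal (fan j c)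
    maximal d uncrossed with fan j c d in presence
    ... | true  = refl
    ... | false with absent-crossed d presence
    ...   | d′ , present′ , crosses = ⊥-elim (uncrossed d′ present′ crosses)

    cspt : CSPT (fan j c)
    cspt = crossingFree , maximal , fan-symmetric j c

  -- The walk from the left star to the right star

  open Admissible

  free : ℕ → Fin n → Bool
  free j q = does (free? j q)

  only : Side → (Fin n → Bool) → Side → Fin n → Bool
  only L f L = f
  only R f R = f
  only L f R = λ _ → false
  only R f L = λ _ → false

  other : Side → Side
  other L = R
  other R = L

  only-self : ∀ s f q → only s f s q ≡ f q
  only-self L f q = refl
  only-self R f q = refl

  only-other : ∀ s f q → only s f (other s) q ≡ false
  only-other L f q = refl
  only-other R f q = refl

  only-cong : ∀ s X {f g} q → (X ≡ s → f q ≡ g q) → only s f X q ≡ only s g X q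
  only-cong L L q f≡g = f≡g refl
  only-cong R R q f≡g = f≡g refl
  only-cong L R q _   = refl
  only-cong R L q _   = refl

  sweep : Side → ℕ → ChordSet n
  sweep s j = fan j (only s (free j))

  pivot : ChordSet n
  pivot = fan m (λ _ q → does (q ≟ fz))

  last : Fin n
  last = fromℕ (suc m)

  toℕ-last : toℕ last ≡ suc m
  toℕ-last = toℕ-fromℕ (suc m)

  free-last : ∀ {j} → j ≤ m → Free j last
  free-last {j} j≤m = inj₂ (subst (j <_) (sym toℕ-last) (s≤s j≤m))

  zero-before : ∀ b q → 0 < toℕ q → CCWHalf (fz , b) (q , b)
  zero-before b q 0<q = ccwHalf-at (fz , b) (q , b) (offset-from-zero b q) 0<q (toℕ<n q)

  before-zero : ∀ b q → toℕ q ≡ suc m → CCWHalf (q , b) (fz , not b)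
  before-zero b q q≡m+1 = ccwHalf-at (q , b) (fz , not b)
    (offset-opposite-half b q fz 1 (sym (trans (cong (_+ 1) q≡m+1) (+-comm (suc m) 1))) (s<s z<s))
    z<s (s<s z<s)

  before-last : ∀ b q → toℕ q < suc m → CCWHalf (q , b) (last , b)
  before-last b q q<m+1 = ccwHalf-at (q , b) (last , b)
    (offset-same-half b q last (suc m ∸ toℕ q) (trans toℕ-last (sym (m+[n∸m]≡n (<⇒≤ q<m+1))))
      (<-trans d<n n<N))
    (m<n⇒0<n∸m q<m+1) d<n
    where
    d<n : suc m ∸ toℕ q < n
    d<n = s≤s (m∸n≤m (suc m) (toℕ q))

  free-fz : ∀ j → free j fz ≡ true
  free-fz j = dec-true (free? j fz) (inj₁ refl)

  sweep-admissible : ∀ s {j} → j ≤ m → Admissible j (only s (free j))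
  sweep-admissible s j≤m .bounded = j≤m
  sweep-admissible L {j} _ .central-free L q present = does-true⇒ (free? j q) present
  sweep-admissible R {j} _ .central-free R q present = does-true⇒ (free? j q) present
  sweep-admissible L _ .left-right-noncrossing _ _ _ ()
  sweep-admissible R _ .left-right-noncrossing _ _ ()
  sweep-admissible L {j} _ .central-blocked L q _ absent free =
    ⊥-elim (true≢false (trans (sym (dec-true (free? j q) free)) absent))
  sweep-admissible R {j} _ .central-blocked R q _ absent free =
    ⊥-elim (true≢false (trans (sym (dec-true (free? j q) free)) absent))
  sweep-admissible L {j} j≤m .central-blocked R fz b _ _ =
    cen L (last , not b) , dec-true (free? j last) (free-last j≤m) ,
    subst (λ b′ → CCWHalf (last , not b) (fz , b′)) (Boolₚ.not-involutive b)
      (before-zero (not b) last toℕ-last)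
  sweep-admissible L {j} _ .central-blocked R (fs q) b _ _ =
    cen L (fz , b) , free-fz j , zero-before b (fs q) z<s
  sweep-admissible R {j} j≤m .central-blocked L q b _ _ with m≤n⇒m<n∨m≡n (s≤s⁻¹ (toℕ<n q))
  ... | inj₂ q≡m+1 = cen R (fz , not b) , free-fz j , before-zero b q q≡m+1
  ... | inj₁ q<m+1 = cen R (last , b) , dec-true (free? j last) (free-last j≤m) , before-last b q q<m+1
  sweep-admissible L {j} _ .zero-central = L , free-fz j
  sweep-admissible R {j} _ .zero-central = R , free-fz j
  sweep-admissible L {j} _ .free-central _ q j<q = L , dec-true (free? j q) (inj₂ j<q)
  sweep-admissible R {j} _ .free-central _ q j<q = R , dec-true (free? j q) (inj₂ j<q)

  pivot-admissible : Admissible m (λ _ q → does (q ≟ fz))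
  pivot-admissible .bounded = ≤-refl
  pivot-admissible .central-free _ q present = inj₁ (does-true⇒ (q ≟ fz) present)
  pivot-admissible .left-right-noncrossing (p , b) (q , b′) present present′
    with does-true⇒ (p ≟ fz) present | does-true⇒ (q ≟ fz) present′ | relative b b′
  ... | refl | refl | same     = λ (0<d , _) → <-irrefl (sym (offset-from-zero b fz)) 0<d
  ... | refl | refl | opposite = λ (_ , d<n) → <-irrefl (offset-from-zero-opposite b fz) d<n
  pivot-admissible .central-blocked X fz b absent _ = ⊥-elim (true≢false absent)
  pivot-admissible .central-blocked X (fs q) b _ (inj₂ m<q) with ≤-antisym (s≤s⁻¹ (toℕ<n (fs q))) m<q
  pivot-admissible .central-blocked L (fs q) b _ _ | q≡m+1 =
    cen R (fz , not b) , refl , before-zero b (fs q) q≡m+1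
  pivot-admissible .central-blocked R (fs q) b _ _ | _ =
    cen L (fz , b) , refl , zero-before b (fs q) z<s
  pivot-admissible .zero-central = L , refl
  pivot-admissible .free-central m<m = ⊥-elim (<-irrefl refl m<m)

  free-step : ∀ {j q} → toℕ q ≢ suc j → free j q ≡ free (suc j) q
  free-step {j} {q} q≢j+1 = does-⇔
    (mk⇔ (map₂ (λ j<q → ≤∧≢⇒< j<q (q≢j+1 ∘ sym))) (map₂ (<-trans (n<1+n j))))
    (free? j q) (free? (suc j) q)

  free-m : ∀ {q} → q ≢ last → free m q ≡ does (q ≟ fz)
  free-m {q} q≢last = does-⇔ (mk⇔ free⇒zero inj₁) (free? m q) (q ≟ fz)
    where
    free⇒zero : Free m q → q ≡ fz
    free⇒zero (inj₁ q≡0) = q≡0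
    free⇒zero (inj₂ m<q) =
      ⊥-elim (q≢last (toℕ-injective (trans (≤-antisym (s≤s⁻¹ (toℕ<n q)) m<q) (sym toℕ-last))))

  sweep-step : ∀ s {j} → j < m → Flip (sweep s j) (sweep s (suc j))
  sweep-step s {j} j<m =
    FanCSPT.cspt (sweep-admissible s (<⇒≤ j<m)) , FanCSPT.cspt (sweep-admissible s j<m) ,
    cen s (q , false) , diag (fz , false) k ,
    trans (only-self s (free j) q) (dec-true (free? j q) (inj₂ j<q)) ,
    trans (only-self s (free (suc j)) q) (dec-false (free? (suc j) q) q-covered) ,
    fan-diagonal {c = only s (free (suc j))} false k (subst (_< suc j) (sym k≡j) ≤-refl) ,
    dec-false (fz {suc m} ≟ fz ×-dec toℕ k <? j) (λ (_ , k<j) → <-irrefl k≡j k<j) ,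
    unchanged
    where
    q<n : suc j < n
    q<n = s≤s (s≤s (<⇒≤ j<m))
    q : Fin n
    q = fromℕ< q<n
    q≡j+1 : toℕ q ≡ suc j
    q≡j+1 = toℕ-fromℕ< q<n
    j<q : j < toℕ q
    j<q = subst (j <_) (sym q≡j+1) ≤-refl
    q-covered : ¬ Free (suc j) q
    q-covered (inj₁ q≡0)    = 0≢1+n (trans (sym (cong toℕ q≡0)) q≡j+1)
    q-covered (inj₂ j+1<q) = <-irrefl (sym q≡j+1) j+1<q
    k : Fin m
    k = fromℕ< j<m
    k≡j : toℕ k ≡ j
    k≡j = toℕ-fromℕ< j<m
    unchanged : ∀ d → d ≢ cen s (q , false) → d ≢ cen s (q , true) →
                d ≢ diag (fz , false) k → d ≢ diag (fz , true) k → sweep s j d ≡ sweep s (suc j) d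
    unchanged (diag (fs _ , _) _) _ _ _ _ = refl
    unchanged (diag (fz , b) k′) _ _ ≢c′ ≢c̄′ = does-<-step λ k′≡j →
      diag-pair-index ≢c′ ≢c̄′ refl (toℕ-injective (trans k′≡j (sym k≡j)))
    unchanged (cen X (q′ , b)) ≢c ≢c̄ _ _ = only-cong s X q′ λ X≡s → free-step λ q′≡j+1 →
      cen-pair-index ≢c ≢c̄ X≡s (toℕ-injective (trans q′≡j+1 (sym q≡j+1)))

  sweep-pivot-central : ∀ s X q b →
    cen X (q , b) ≢ cen s (last , false) → cen X (q , b) ≢ cen s (last , true) →
    cen X (q , b) ≢ cen (other s) (fz , false) → cen X (q , b) ≢ cen (other s) (fz , true) →
    only s (free m) X q ≡ does (q ≟ fz)
  sweep-pivot-central L L q b ≢c ≢c̄ _ _ = free-m (cen-pair-index ≢c ≢c̄ refl)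
  sweep-pivot-central R R q b ≢c ≢c̄ _ _ = free-m (cen-pair-index ≢c ≢c̄ refl)
  sweep-pivot-central L R q b _ _ ≢c′ ≢c̄′ =
    sym (dec-false (q ≟ fz) (cen-pair-index ≢c′ ≢c̄′ refl))
  sweep-pivot-central R L q b _ _ ≢c′ ≢c̄′ =
    sym (dec-false (q ≟ fz) (cen-pair-index ≢c′ ≢c̄′ refl))

  sweep-to-pivot : ∀ s → Flip (sweep s m) pivot
  sweep-to-pivot s =
    FanCSPT.cspt (sweep-admissible s ≤-refl) , FanCSPT.cspt pivot-admissible ,
    cen s (last , false) , cen (other s) (fz , false) ,
    trans (only-self s (free m) last) (dec-true (free? m last) (free-last ≤-refl)) ,
    refl , refl , only-other s (free m) fz , unchanged
    where
    unchanged : ∀ d → d ≢ cen s (last , false) → d ≢ cen s (last , true) →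
                d ≢ cen (other s) (fz , false) → d ≢ cen (other s) (fz , true) → sweep s m d ≡ pivot d
    unchanged (diag _ _)      _ _ _ _ = refl
    unchanged (cen X (q , b)) = sweep-pivot-central s X q b

  free-0 : ∀ q → free 0 q ≡ true
  free-0 fz     = free-fz 0
  free-0 (fs q) = dec-true (free? 0 (fs q)) (inj₂ z<s)

  leftStar≐sweep : leftStar n ≐ sweep L 0
  leftStar≐sweep (diag (p , _) k) = sym (dec-false (p ≟ fz ×-dec toℕ k <? 0) λ ())
  leftStar≐sweep (cen L (q , _))  = sym (free-0 q)
  leftStar≐sweep (cen R _)        = refl

  sweep≐rightStar : sweep R 0 ≐ rightStar n
  sweep≐rightStar (diag (p , _) k) = dec-false (p ≟ fz ×-dec toℕ k <? 0) λ ()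
  sweep≐rightStar (cen R (q , _))  = free-0 q
  sweep≐rightStar (cen L _)        = refl

  flip-distance-upper : Walk (leftStar n) (rightStar n) (2 * n ∸ 2)
  flip-distance-upper =
    subst (Walk (leftStar n) (rightStar n)) (cong (m +_) (sym (+-identityʳ (2 + m))))
      (walk-respˡ leftStar≐sweep
        (walk-respʳ (walk-++ sweep-left (walk-++ turn sweep-right)) sweep≐rightStar))
    where
    sweep-left : Walk (sweep L 0) (sweep L m) m
    sweep-left = walk-chain (sweep L) m (λ _ → sweep-step L)
    turn : Walk (sweep L m) (sweep R m) 2
    turn = step (sweep-to-pivot L) (step (flip-sym (sweep-to-pivot R)) (here λ _ → refl))
    sweep-right : Walk (sweep R m) (sweep R 0) m
    sweep-right = walk-sym (walk-chain (sweep R) m (λ _ → sweep-step R))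

lemma3p2 : (n : ℕ) → 2 ≤ n → FlipDistance (leftStar n) (rightStar n) (2 * n ∸ 2)
lemma3p2 (suc (suc m)) (s≤s (s≤s z≤n)) =
  Polygon.flip-distance-upper m , λ k → Polygon.flip-distance-lower m
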